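{- Let $\langle X_\alpha:\alpha<\kappa\rangle$ be a promptly splitting family (i.e. $\{X_\alpha:\alpha<\kappa\}$ is promptly splitting), where $\kappa$ is a cardinal. Then there exists a tortuous coloring on $\kappa$.
   Context: For $x\subseteq\omega$ write $x^0=x$, $x^1=\omega\setminus x$. A sequence $\langle x_i:i\in\omega\rangle\in(\mathcal{P}(\omega))^\omega$ promptly splits $a\subseteq\omega$ if for all $n\in\omega$ and $\sigma\in 2^{n+1}$, $\left(\bigcap_{i<n+1}x_i^{\sigma(i)}\right)\cap a$ is infinite; a family $\mathcal{F}\subseteq(\mathcal{P}(\omega))^\omega$ is promptly splitting if every infinite $a\subseteq\omega$ is promptly split by some member. A partition of $\kappa$ is a sequence $\langle K_n:n\in\omega\rangle$ of pairwise disjoint (possibly empty) subsets of $\kappa$ with union $\kappa$. A coloring $c:\kappa\times\omega\times\omega\to2$ is a tortuous coloring on $\kappa$ if for each infinite $A\subseteq\omega$ and each partition $\langle K_n:n\in\omega\rangle$ of $\kappa$ there is $n\in\omega$ such that for every $\sigma\in2^{n+1}$ there exist $\alpha\in K_n$ and $k\in A$ with $k>n$ and $\sigma(i)=c(\alpha,k,i)$ for all $i<n+1$. -}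

module Defs where

open import Level using (Level; suc; _⊔_)
open import Data.Nat using (ℕ; _≤_; _<_)
open import Data.Fin using (Fin; toℕ)
open import Data.Bool using (Bool; true; false; not)
open import Data.Product using (Σ; ∃; _×_; _,_)
open import Relation.Binary.PropositionalEquality using (_≡_)

-- Subsets of ω, represented by their characteristic functions.
-- Bits (elements of 2) are Booleans: false = 0, true = 1.
Subsetω : Set
Subsetω = ℕ → Bool

_∈ω_ : ℕ → Subsetω → Set
k ∈ω x = x k ≡ true

_^_ : Subsetω → Bool → Subsetω
(x ^ false) k = x k
(x ^ true)  k = not (x k)

InfiniteP : (ℕ → Set) → Set
InfiniteP P = ∀ m → ∃ λ k → m ≤ k × P k

Infinite : Subsetω → Set
Infinite a = InfiniteP (λ k → k ∈ω a)

PromptlySplits : (ℕ → Subsetω) → Subsetω → Set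
PromptlySplits x a =
  ∀ (n : ℕ) (σ : Fin (Data.Nat.suc n) → Bool) →
    InfiniteP (λ k → (∀ (i : Fin (Data.Nat.suc n)) → k ∈ω (x (toℕ i) ^ σ i)) × k ∈ω a)

PromptlySplitting : ∀ {ℓ} {K : Set ℓ} → (K → (ℕ → Subsetω)) → Set ℓ
PromptlySplitting {K = K} X = ∀ (a : Subsetω) → Infinite a → ∃ λ (α : K) → PromptlySplits (X α) a

record Partition {ℓ} (K : Set ℓ) : Set ℓ where
  field
    part     : ℕ → K → Bool
    disjoint : ∀ (m n : ℕ) (α : K) → part m α ≡ true → part n α ≡ true → m ≡ n
    covers   : ∀ (α : K) → ∃ λ n → part n α ≡ true

Tortuous : ∀ {ℓ} {K : Set ℓ} → (K → ℕ → ℕ → Bool) → Set ℓ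
Tortuous {ℓ} {K} c =
  ∀ (A : Subsetω) → Infinite A → (P : Partition K) →
    ∃ λ (n : ℕ) → ∀ (σ : Fin (Data.Nat.suc n) → Bool) →
      Σ K λ α → Partition.part P n α ≡ true ×
        ∃ λ (k : ℕ) → k ∈ω A × n < k ×
          (∀ (i : Fin (Data.Nat.suc n)) → σ i ≡ c α k (toℕ i))

module Submission where

open import Defs
open import Level using (Level)
open import Data.Nat using (ℕ; suc; _<_)
open import Data.Fin using (Fin; toℕ)
open import Data.Bool using (Bool; true; false; not)
open import Data.Product using (Σ; ∃; _×_; _,_)
open import Relation.Binary.PropositionalEquality using (_≡_; sym; cong)

-- Colour (α, k, i) by whether k lies in X_α(i); a splitting index α then realises
-- every pattern σ ∈ 2^{n+1} on infinitely many k ∈ A, in particular for the n with α ∈ K_n.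

^-member⇒≡not : ∀ (x : Subsetω) (b : Bool) (k : ℕ) → k ∈ω (x ^ b) → b ≡ not (x k)
^-member⇒≡not x false k k∈x = sym (cong not k∈x)
^-member⇒≡not x true  k k∉x = sym k∉x

-- c(α, k, i) = 0 exactly when k ∈ X_α(i), so σ(i) = c(α, k, i) iff k ∈ X_α(i)^{σ(i)}.
membershipColouring : ∀ {ℓ} {K : Set ℓ} → (K → ℕ → Subsetω) → K → ℕ → ℕ → Bool
membershipColouring X α k i = not (X α i k)

promptlySplitting⇒tortuous : ∀ {ℓ} {K : Set ℓ} (X : K → ℕ → Subsetω) →
  PromptlySplitting X → Tortuous (membershipColouring X)
promptlySplitting⇒tortuous {K = K} X splitting A A-infinite P
  with splitting A A-infinite
... | α , α-splits with Partition.covers P α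
... | n , α∈Kₙ = n , realise
  where
  realise : ∀ (σ : Fin (suc n) → Bool) → Σ K λ β → Partition.part P n β ≡ true ×
    ∃ λ k → k ∈ω A × n < k × (∀ i → σ i ≡ membershipColouring X β k (toℕ i))
  realise σ with α-splits n σ (suc n)
  ... | k , n<k , (k∈⋂ , k∈A) =
    α , α∈Kₙ , k , k∈A , n<k , λ i → ^-member⇒≡not (X α (toℕ i)) (σ i) k (k∈⋂ i)

lemma2p5 : ∀ {ℓ : Level} (K : Set ℓ) (X : K → (ℕ → Subsetω)) →
    PromptlySplitting X → ∃ λ (c : K → ℕ → ℕ → Bool) → Tortuous c
lemma2p5 K X splitting = membershipColouring X , promptlySplitting⇒tortuous X splitting
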